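{- Let $K$ be a field with a discrete henselian valuation $v$ and let $\alpha \in K$. Let $f$ be a polynomial over $K$ of even degree with $f(0) \neq 0$. Assume that the Newton polygon of $f$ has only one edge, with slope $m$. Assume that $m \neq -v(\alpha)$ and let $N \in \mathbb{N}$ be such that $N > v(4)/|m + v(\alpha)|$. Assume that $f = a(t) + g(t) t^N + z(t) t^{2 N + \deg g - \deg z}$, where $a, g, z$ are polynomials over $K$, $\deg g$ and $\deg z$ are even, and $\deg a < N$, $\deg z < N$. If $m < -v(\alpha)$, then $f(\alpha) = z(\alpha)$ in $K^*/K^{*2}$. If $m > -v(\alpha)$, then $f(\alpha) = a(\alpha)$ in $K^*/K^{*2}$.
   Context: The Newton polygon of a polynomial $a_0 + a_1 t + \dots + a_d t^d$ with $a_0a_d\neq 0$ is the lower convex hull of the points $(i, v(a_i))$ in $\mathbb{R}^2$. $K^*/K^{*2}$ denotes the group of square classes. -}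

module Defs where

open import Level using (Level; _⊔_)
open import Algebra.Bundles using (CommutativeRing)
open import Data.Bool using (if_then_else_)
open import Data.Nat as ℕ using (ℕ; zero; suc; _<_; _≤_; _∸_; _≤ᵇ_)
open import Data.Integer as ℤ using (ℤ; +_)
open import Data.Rational as ℚ using (ℚ)
open import Data.Product using (Σ; ∃; _×_; _,_)
open import Data.Sum using (_⊎_)
open import Relation.Nullary using (¬_)
open import Relation.Binary.PropositionalEquality using (_≡_)

record Field (c ℓ : Level) : Set (Level.suc (c ⊔ ℓ)) where
  field
    commutativeRing : CommutativeRing c ℓ
  open CommutativeRing commutativeRing public
  field
    0≉1     : ¬ (0# ≈ 1#)
    inverse : ∀ x → ¬ (x ≈ 0#) → ∃ λ y → (x * y) ≈ 1#

data ℤ∞ : Set where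
  fin : ℤ → ℤ∞
  ∞   : ℤ∞

_+∞_ : ℤ∞ → ℤ∞ → ℤ∞
fin a +∞ fin b = fin (a ℤ.+ b)
fin _ +∞ ∞     = ∞
∞     +∞ _     = ∞

min∞ : ℤ∞ → ℤ∞ → ℤ∞
min∞ (fin a) (fin b) = fin (a ℤ.⊓ b)
min∞ (fin a) ∞       = fin a
min∞ ∞       y       = y

data _≤∞_ : ℤ∞ → ℤ∞ → Set where
  fin≤fin : ∀ {a b} → a ℤ.≤ b → fin a ≤∞ fin b
  _≤∞∞    : ∀ x → x ≤∞ ∞

ℤ→ℚ : ℤ → ℚ
ℤ→ℚ k = k ℚ./ 1

ℕ→ℚ : ℕ → ℚ
ℕ→ℚ n = (+ n) ℚ./ 1

module _ {c ℓ : Level} (F : Field c ℓ) where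
  open Field F

  record DiscreteValuation : Set (c ⊔ ℓ) where
    field
      v        : Carrier → ℤ∞
      v-cong   : ∀ {x y} → x ≈ y → v x ≡ v y
      v-∞⇒0    : ∀ x → v x ≡ ∞ → x ≈ 0#
      0⇒v-∞    : ∀ x → x ≈ 0# → v x ≡ ∞
      v-mul    : ∀ x y → v (x * y) ≡ (v x +∞ v y)
      v-add    : ∀ x y → min∞ (v x) (v y) ≤∞ v (x + y)
      v-surj   : ∀ (k : ℤ) → ∃ λ x → v x ≡ fin k

  -- Nonzero polynomials over K, given by degree and coefficient sequence
  -- (coeff i = coefficient of t^i).

  record Poly : Set (c ⊔ ℓ) where
    field
      deg    : ℕ
      coeff  : ℕ → Carrier
      vanish : ∀ i → deg < i → coeff i ≈ 0#
      lead   : ¬ (coeff deg ≈ 0#)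
  open Poly public

  pow : Carrier → ℕ → Carrier
  pow x zero    = 1#
  pow x (suc n) = pow x n * x

  Σ< : ℕ → (ℕ → Carrier) → Carrier
  Σ< zero    h = 0#
  Σ< (suc n) h = Σ< n h + h n

  _·ℕ_ : ℕ → Carrier → Carrier
  zero  ·ℕ x = 0#
  suc n ·ℕ x = (n ·ℕ x) + x

  eval : Poly → Carrier → Carrier
  eval p x = Σ< (suc (deg p)) (λ i → coeff p i * pow x i)

  evalDeriv : Poly → Carrier → Carrier
  evalDeriv p x = Σ< (deg p) (λ i → (suc i ·ℕ coeff p (suc i)) * pow x i)

  -- coefficient of t^i in p(t) · t^k
  shiftCoeff : Poly → ℕ → ℕ → Carrier
  shiftCoeff p k i = if k ≤ᵇ i then coeff p (i ∸ k) else 0#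

  four : Carrier
  four = ((1# + 1#) + 1#) + 1#

  SameSquareClass : Carrier → Carrier → Set (c ⊔ ℓ)
  SameSquareClass x y =
    ¬ (x ≈ 0#) × ¬ (y ≈ 0#) × (∃ λ s → ¬ (s ≈ 0#) × (x ≈ (y * (s * s))))

  module _ (V : DiscreteValuation) where
    open DiscreteValuation V

    -- Henselian: Hensel's lemma for monic polynomials over the valuation
    -- ring O = {v ≥ 0}: a simple root mod the maximal ideal lifts.
    IsHenselian : Set (c ⊔ ℓ)
    IsHenselian =
      ∀ (P : Poly) → coeff P (deg P) ≈ 1# →
      (∀ i → fin (+ 0) ≤∞ v (coeff P i)) →
      ∀ (a : Carrier) → fin (+ 0) ≤∞ v a →
      fin (+ 1) ≤∞ v (eval P a) →
      v (evalDeriv P a) ≡ fin (+ 0) →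
      ∃ λ b → (eval P b ≈ 0#) × (fin (+ 1) ≤∞ v (b + (- a)))

    AboveOrOn : ℚ → ℤ∞ → Set
    AboveOrOn q ∞       = Data.Unit.⊤ where import Data.Unit
    AboveOrOn q (fin w) = q ℚ.≤ ℤ→ℚ w

    -- The Newton polygon of f (lower convex hull of the points (i, v(a_i)),
    -- a_i ≠ 0) consists of exactly one edge, of slope m: deg f ≥ 1 and all
    -- points lie on or above the segment from (0, v(a_0)) to (d, v(a_d)),
    -- which has slope m.
    NewtonPolygonOneEdge : Poly → ℚ → Set
    NewtonPolygonOneEdge f m =
      1 ≤ deg f ×
      (∃ λ w₀ → v (coeff f 0) ≡ fin w₀ ×
        (∃ λ wd → v (coeff f (deg f)) ≡ fin wd ×
           ℤ→ℚ wd ≡ ℤ→ℚ w₀ ℚ.+ ℕ→ℚ (deg f) ℚ.* m) ×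
        (∀ i → i ≤ deg f →
           AboveOrOn (ℤ→ℚ w₀ ℚ.+ ℕ→ℚ i ℚ.* m) (v (coeff f i))))

    SlopeNeq : ℚ → Carrier → Set
    SlopeNeq m α = v α ≡ ∞ ⊎ (∃ λ k → v α ≡ fin k × ¬ (m ≡ ℚ.- ℤ→ℚ k))

    SlopeBelow : ℚ → Carrier → Set
    SlopeBelow m α = ∃ λ k → v α ≡ fin k × m ℚ.< ℚ.- ℤ→ℚ k

    -- m > -v(α)   (automatic when v(α) = ∞)
    SlopeAbove : ℚ → Carrier → Set
    SlopeAbove m α = v α ≡ ∞ ⊎ (∃ λ k → v α ≡ fin k × ℚ.- ℤ→ℚ k ℚ.< m)

    -- N > v(4) / |m + v(α)|   (with v(4)/∞ = 0, and no N if v(4) = ∞)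
    NBound : ℕ → ℚ → Carrier → Set
    NBound N m α =
      ∃ λ w → v four ≡ fin w ×
        ((v α ≡ ∞ × 0 < N) ⊎
         (∃ λ k → v α ≡ fin k ×
            ℤ→ℚ w ℚ.< ℕ→ℚ N ℚ.* ℚ.∣ m ℚ.+ ℤ→ℚ k ∣))

-- Write tᵢ = fᵢαⁱ. Substituting t = αu shifts the single edge of the Newton polygon
-- to slope d = m + v(α), so v(tᵢ) ≥ v(f₀) + i·d with equality at both ends.
--
-- If d > 0, then a(α) = Σ_{i<N} tᵢ has valuation v(t₀), while every tᵢ with i ≥ N
-- exceeds it by more than N·d > v(4). If d < 0, the terms of index ≥ S = 2N + deg g − deg z
-- sum to z(α)·α^S, whose valuation is that of the top term t_{deg f}; the coefficients of f
-- vanish strictly between N + deg g and S, and all lower terms exceed it by more than v(4).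
--
-- Either way f(α) = y + T with v(T) > v(y) + v(4), so f(α)/y = 1 + 4e with v(e) ≥ 1, which is a
-- square by Hensel's lemma for t² + t − e. As S is even, z(α)·α^S lies in the class of z(α).

module Submission where

open import Level using (Level)
open import Data.Bool using (true; false; T)
open import Data.Empty using (⊥-elim)
open import Data.Unit using (tt)
open import Data.Nat as ℕ using (ℕ; zero; suc; z≤n; s≤s)
import Data.Nat.Properties as ℕP
open import Data.Nat.Divisibility using (_∣_; divides)
import Data.Nat.Solver
open import Data.Integer as ℤ using (ℤ; +_; -[1+_])
import Data.Integer.Properties as ℤP
import Data.Integer.Solver
open import Data.Rational as ℚ using (ℚ; mkℚ; 0ℚ)
import Data.Rational.Properties as ℚP
import Data.Rational.Solver
import Data.Nat.Coprimality as Coprimality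
open import Data.Product using (∃; _×_; _,_; proj₁; proj₂)
open import Data.Sum using (_⊎_; inj₁; inj₂; [_,_])
open import Relation.Nullary using (¬_; yes; no)
open import Relation.Binary.Definitions using (tri<; tri≈; tri>)
open import Relation.Binary.PropositionalEquality as ≡
  using (_≡_; refl; cong; cong₂; subst; subst₂)
import Algebra.Solver.Ring.NaturalCoefficients.Default as NaturalCoefficientsSolver
import Relation.Binary.Reasoning.Setoid as SetoidReasoning
open import Defs

infix 4 _<∞_

_<∞_ : ℤ → ℤ∞ → Set
b <∞ x = fin (ℤ.suc b) ≤∞ x

≤∞-trans : ∀ {x y z} → x ≤∞ y → y ≤∞ z → x ≤∞ z
≤∞-trans (fin≤fin p) (fin≤fin q) = fin≤fin (ℤP.≤-trans p q)
≤∞-trans (fin≤fin _) (_ ≤∞∞)     = _ ≤∞∞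
≤∞-trans (x ≤∞∞)     (.∞ ≤∞∞)    = x ≤∞∞

≤∞-reflexive : ∀ {x y} → x ≡ y → x ≤∞ y
≤∞-reflexive {fin a} refl = fin≤fin ℤP.≤-refl
≤∞-reflexive {∞}     refl = ∞ ≤∞∞

min∞-glb : ∀ {b x y} → fin b ≤∞ x → fin b ≤∞ y → fin b ≤∞ min∞ x y
min∞-glb (fin≤fin p) (fin≤fin q) = fin≤fin (ℤP.⊓-glb p q)
min∞-glb (fin≤fin p) (_ ≤∞∞)     = fin≤fin p
min∞-glb (_ ≤∞∞)     q           = q

<∞⇒≤∞ : ∀ {b x} → b <∞ x → fin b ≤∞ x
<∞⇒≤∞ = ≤∞-trans (fin≤fin (ℤP.i≤suc[i] _))

<∞-weaken : ∀ {a b x} → a ℤ.≤ b → b <∞ x → a <∞ x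
<∞-weaken a≤b = ≤∞-trans (fin≤fin (ℤP.+-monoʳ-≤ (+ 1) a≤b))

<∞-irrefl : ∀ {a} → ¬ (a <∞ fin a)
<∞-irrefl (fin≤fin p) = ℤP.<-irrefl refl (ℤP.suc[i]≤j⇒i<j p)

≤∞∧≮∞⇒≡ : ∀ {a x} → fin a ≤∞ x → ¬ (a <∞ x) → x ≡ fin a
≤∞∧≮∞⇒≡ (fin≤fin a≤b) a≮b =
  cong fin (ℤP.≤-antisym (ℤP.≮⇒≥ λ a<b → a≮b (fin≤fin (ℤP.i<j⇒suc[i]≤j a<b))) a≤b)
≤∞∧≮∞⇒≡ (_ ≤∞∞) a≮∞ = ⊥-elim (a≮∞ (_ ≤∞∞))

+∞-identityˡ : ∀ x → fin (+ 0) +∞ x ≡ x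
+∞-identityˡ (fin a) = cong fin (ℤP.+-identityˡ a)
+∞-identityˡ ∞       = refl

+∞-zeroʳ : ∀ x → x +∞ ∞ ≡ ∞
+∞-zeroʳ (fin _) = refl
+∞-zeroʳ ∞       = refl

≤∞-fin⁻¹ : ∀ {a b} → fin a ≤∞ fin b → a ℤ.≤ b
≤∞-fin⁻¹ (fin≤fin a≤b) = a≤b

≡∞⇒≤∞ : ∀ {x y} → y ≡ ∞ → x ≤∞ y
≡∞⇒≤∞ refl = _ ≤∞∞

fin≢∞ : ∀ {a} → ¬ (fin a ≡ ∞)
fin≢∞ ()

fin-injective : ∀ {a b} → fin a ≡ fin b → a ≡ b
fin-injective refl = refl

+-cancelˡ-≤ : ∀ a {b c} → a ℤ.+ b ℤ.≤ a ℤ.+ c → b ℤ.≤ c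
+-cancelˡ-≤ a {b} {c} le = subst₂ ℤ._≤_ (-a+[a+x]≡x b) (-a+[a+x]≡x c) (ℤP.+-monoʳ-≤ (ℤ.- a) le)
  where
  open Data.Integer.Solver.+-*-Solver
  -a+[a+x]≡x : ∀ x → ℤ.- a ℤ.+ (a ℤ.+ x) ≡ x
  -a+[a+x]≡x x = solve 2 (λ a x → :- a :+ (a :+ x) := x) refl a x

<∞-+∞-cancelˡ : ∀ a {x} → a <∞ fin a +∞ x → + 0 <∞ x
<∞-+∞-cancelˡ a {fin e} (fin≤fin p) =
  fin≤fin (+-cancelˡ-≤ a (subst (ℤ._≤ a ℤ.+ e) (ℤP.+-comm (+ 1) a) p))
<∞-+∞-cancelˡ a {∞}     _           = _ ≤∞∞

n+n≡0⇒n≡0 : ∀ n → n ℤ.+ n ≡ + 0 → n ≡ + 0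
n+n≡0⇒n≡0 (+ zero) _ = refl
n+n≡0⇒n≡0 (+ suc n) ()
n+n≡0⇒n≡0 -[1+ n ] ()

m+n<o⇒n<o∸m : ∀ {m n o} → m ℕ.+ n ℕ.< o → n ℕ.< o ℕ.∸ m
m+n<o⇒n<o∸m {m} {n} m+n<o = subst (ℕ._< _) (ℕP.m+n∸m≡n m n) (ℕP.∸-monoˡ-< m+n<o (ℕP.m≤m+n m n))

-- k / 1 is normalised by a gcd computation, so it only reduces for concrete k
ℤ→ℚ≡mkℚ : ∀ a → ℤ→ℚ a ≡ mkℚ a 0 (Coprimality.sym (Coprimality.1-coprimeTo _))
ℤ→ℚ≡mkℚ a = ℚP.↥p/↧p≡p (mkℚ a 0 (Coprimality.sym (Coprimality.1-coprimeTo _)))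

ℤ→ℚ-+ : ∀ a b → ℤ→ℚ (a ℤ.+ b) ≡ ℤ→ℚ a ℚ.+ ℤ→ℚ b
ℤ→ℚ-+ a b rewrite ℤ→ℚ≡mkℚ a | ℤ→ℚ≡mkℚ b =
  cong (ℚ._/ 1) (cong₂ ℤ._+_ (≡.sym (ℤP.*-identityʳ a)) (≡.sym (ℤP.*-identityʳ b)))

ℤ→ℚ-* : ∀ a b → ℤ→ℚ (a ℤ.* b) ≡ ℤ→ℚ a ℚ.* ℤ→ℚ b
ℤ→ℚ-* a b rewrite ℤ→ℚ≡mkℚ a | ℤ→ℚ≡mkℚ b = refl

ℤ→ℚ-mono-≤ : ∀ {a b} → a ℤ.≤ b → ℤ→ℚ a ℚ.≤ ℤ→ℚ b
ℤ→ℚ-mono-≤ {a} {b} a≤b rewrite ℤ→ℚ≡mkℚ a | ℤ→ℚ≡mkℚ b =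
  ℚ.*≤* (subst₂ ℤ._≤_ (≡.sym (ℤP.*-identityʳ a)) (≡.sym (ℤP.*-identityʳ b)) a≤b)

ℤ→ℚ-cancel-< : ∀ {a b} → ℤ→ℚ a ℚ.< ℤ→ℚ b → a ℤ.< b
ℤ→ℚ-cancel-< {a} {b} a<b rewrite ℤ→ℚ≡mkℚ a | ℤ→ℚ≡mkℚ b with a<b
... | ℚ.*<* a*1<b*1 = subst₂ ℤ._<_ (ℤP.*-identityʳ a) (ℤP.*-identityʳ b) a*1<b*1

ℕ→ℚ-+ : ∀ m n → ℕ→ℚ (m ℕ.+ n) ≡ ℕ→ℚ m ℚ.+ ℕ→ℚ n
ℕ→ℚ-+ m n = ≡.trans (cong ℤ→ℚ (ℤP.pos-+ m n)) (ℤ→ℚ-+ (+ m) (+ n))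

ℕ→ℚ-mono-≤ : ∀ {m n} → m ℕ.≤ n → ℕ→ℚ m ℚ.≤ ℕ→ℚ n
ℕ→ℚ-mono-≤ m≤n = ℤ→ℚ-mono-≤ (ℤ.+≤+ m≤n)

module _ where
  open import Data.Rational using (_+_; _*_; -_; _<_; _≤_; ∣_∣)
  open Data.Rational.Solver.+-*-Solver

  p<0⇒∣p∣≡-p : ∀ {p} → p < 0ℚ → ∣ p ∣ ≡ - p
  p<0⇒∣p∣≡-p {p} p<0 = ≡.trans (≡.sym (ℚP.∣-p∣≡∣p∣ p)) (ℚP.0≤p⇒∣p∣≡p (ℚP.<⇒≤ (ℚP.neg-antimono-< p<0)))

  line-shift : ∀ (w₀ wᵢ k : ℤ) (i : ℕ) (m : ℚ) → ℤ→ℚ w₀ + ℕ→ℚ i * m ≤ ℤ→ℚ wᵢ →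
               ℤ→ℚ w₀ + ℕ→ℚ i * (m + ℤ→ℚ k) ≤ ℤ→ℚ (wᵢ ℤ.+ + i ℤ.* k)
  line-shift w₀ wᵢ k i m below = begin
    ℤ→ℚ w₀ + ℕ→ℚ i * (m + ℤ→ℚ k)
      ≡⟨ solve 4 (λ a b c d → a :+ b :* (c :+ d) := (a :+ b :* c) :+ b :* d) refl
           (ℤ→ℚ w₀) (ℕ→ℚ i) m (ℤ→ℚ k) ⟩
    (ℤ→ℚ w₀ + ℕ→ℚ i * m) + ℕ→ℚ i * ℤ→ℚ k ≤⟨ ℚP.+-monoˡ-≤ (ℕ→ℚ i * ℤ→ℚ k) below ⟩
    ℤ→ℚ wᵢ + ℕ→ℚ i * ℤ→ℚ k                ≡⟨ cong (λ x → ℤ→ℚ wᵢ + x) (ℤ→ℚ-* (+ i) k) ⟨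
    ℤ→ℚ wᵢ + ℤ→ℚ (+ i ℤ.* k)              ≡⟨ ℤ→ℚ-+ wᵢ (+ i ℤ.* k) ⟨
    ℤ→ℚ (wᵢ ℤ.+ + i ℤ.* k)                ∎
    where open ℚP.≤-Reasoning

  line-shift-≡ : ∀ (w₀ w k : ℤ) (i : ℕ) (m : ℚ) → ℤ→ℚ w ≡ ℤ→ℚ w₀ + ℕ→ℚ i * m →
                 ℤ→ℚ (w ℤ.+ + i ℤ.* k) ≡ ℤ→ℚ w₀ + ℕ→ℚ i * (m + ℤ→ℚ k)
  line-shift-≡ w₀ w k i m on = begin
    ℤ→ℚ (w ℤ.+ + i ℤ.* k)                  ≡⟨ ℤ→ℚ-+ w (+ i ℤ.* k) ⟩
    ℤ→ℚ w + ℤ→ℚ (+ i ℤ.* k)                ≡⟨ cong₂ _+_ on (ℤ→ℚ-* (+ i) k) ⟩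
    (ℤ→ℚ w₀ + ℕ→ℚ i * m) + ℕ→ℚ i * ℤ→ℚ k
      ≡⟨ solve 4 (λ a b c d → (a :+ b :* c) :+ b :* d := a :+ b :* (c :+ d)) refl
           (ℤ→ℚ w₀) (ℕ→ℚ i) m (ℤ→ℚ k) ⟩
    ℤ→ℚ w₀ + ℕ→ℚ i * (m + ℤ→ℚ k)           ∎
    where open ≡.≡-Reasoning

  line-descending : ∀ (q : ℚ) (c : ℤ) (i r : ℕ) {d : ℚ} → d < 0ℚ →
                    ℤ→ℚ c ≡ q + ℕ→ℚ (i ℕ.+ r) * d → q + ℕ→ℚ i * d ≡ ℤ→ℚ c + ℕ→ℚ r * ∣ d ∣
  line-descending q c i r {d} d<0 on = begin
    q + ℕ→ℚ i * d
      ≡⟨ solve 4 (λ q i r d → q :+ i :* d := (q :+ (i :+ r) :* d) :+ r :* (:- d)) refl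
           q (ℕ→ℚ i) (ℕ→ℚ r) d ⟩
    (q + (ℕ→ℚ i + ℕ→ℚ r) * d) + ℕ→ℚ r * - d ≡⟨ cong₂ (λ x y → (q + x * d) + ℕ→ℚ r * y)
                                                    (ℕ→ℚ-+ i r) (p<0⇒∣p∣≡-p d<0) ⟨
    (q + ℕ→ℚ (i ℕ.+ r) * d) + ℕ→ℚ r * ∣ d ∣  ≡⟨ cong (_+ ℕ→ℚ r * ∣ d ∣) on ⟨
    ℤ→ℚ c + ℕ→ℚ r * ∣ d ∣                    ∎
    where open ≡.≡-Reasoning

  +-gap : ∀ (c x : ℤ) {e : ℚ} {n r : ℕ} → ℤ→ℚ x < ℕ→ℚ n * ∣ e ∣ → n ℕ.≤ r →
          ℤ→ℚ (c ℤ.+ x) < ℤ→ℚ c + ℕ→ℚ r * ∣ e ∣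
  +-gap c x {e} {n} {r} x<n∣e∣ n≤r = begin-strict
    ℤ→ℚ (c ℤ.+ x)          ≡⟨ ℤ→ℚ-+ c x ⟩
    ℤ→ℚ c + ℤ→ℚ x          <⟨ ℚP.+-monoʳ-< (ℤ→ℚ c) x<n∣e∣ ⟩
    ℤ→ℚ c + ℕ→ℚ n * ∣ e ∣  ≤⟨ ℚP.+-monoʳ-≤ (ℤ→ℚ c)
                               (ℚP.*-monoʳ-≤-nonNeg ∣ e ∣ {{ℚP.∣-∣-nonNeg e}} (ℕ→ℚ-mono-≤ n≤r)) ⟩
    ℤ→ℚ c + ℕ→ℚ r * ∣ e ∣  ∎
    where open ℚP.≤-Reasoning

module Valuation {c ℓ : Level} (F : Field c ℓ) (V : DiscreteValuation F) where
  open Field F renaming (refl to ≈-refl; sym to ≈-sym; trans to ≈-trans)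
  open DiscreteValuation V
  open import Algebra.Properties.Ring ring using (-1*x≈-x; -‿involutive)
  open import Algebra.Properties.Group +-group using (//-rightDividesʳ)

  v-0 : v 0# ≡ ∞
  v-0 = 0⇒v-∞ 0# ≈-refl

  v≡fin⇒≉0 : ∀ {x a} → v x ≡ fin a → ¬ (x ≈ 0#)
  v≡fin⇒≉0 {x} vx x≈0 with ≡.trans (≡.sym vx) (0⇒v-∞ x x≈0)
  ... | ()

  ≉0⇒v≡fin : ∀ {x} → ¬ (x ≈ 0#) → ∃ λ a → v x ≡ fin a
  ≉0⇒v≡fin {x} x≉0 with v x in vx
  ... | fin a = a , refl
  ... | ∞     = ⊥-elim (x≉0 (v-∞⇒0 x vx))

  v-*-fin : ∀ {x y a b} → v x ≡ fin a → v y ≡ fin b → v (x * y) ≡ fin (a ℤ.+ b)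
  v-*-fin {x} {y} vx vy = ≡.trans (v-mul x y) (cong₂ _+∞_ vx vy)

  v-*-∞ˡ : ∀ {x y} → v x ≡ ∞ → v (x * y) ≡ ∞
  v-*-∞ˡ {x} {y} vx = ≡.trans (v-mul x y) (cong (_+∞ v y) vx)

  v-*-∞ʳ : ∀ {x y} → v y ≡ ∞ → v (x * y) ≡ ∞
  v-*-∞ʳ {x} {y} vy = ≡.trans (v-mul x y) (≡.trans (cong (v x +∞_) vy) (+∞-zeroʳ (v x)))

  *-≉0 : ∀ {x y} → ¬ (x ≈ 0#) → ¬ (y ≈ 0#) → ¬ (x * y ≈ 0#)
  *-≉0 x≉0 y≉0 with ≉0⇒v≡fin x≉0 | ≉0⇒v≡fin y≉0
  ... | _ , vx | _ , vy = v≡fin⇒≉0 (v-*-fin vx vy)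

  v-1 : v 1# ≡ fin (+ 0)
  v-1 with ≉0⇒v≡fin (λ 1≈0 → 0≉1 (≈-sym 1≈0)) | v-surj (+ 0)
  ... | u , v1≡u | x , vx≡0 = ≡.trans v1≡u (cong fin (≡.trans (≡.sym (ℤP.+-identityʳ u)) u+0≡0))
    where
    u+0≡0 : u ℤ.+ + 0 ≡ + 0
    u+0≡0 = fin-injective (≡.trans (≡.sym (v-*-fin v1≡u vx≡0)) (≡.trans (v-cong (*-identityˡ x)) vx≡0))

  v-neg : ∀ x → v (- x) ≡ v x
  v-neg x = begin
    v (- x)           ≡⟨ v-cong (-1*x≈-x x) ⟨
    v (- 1# * x)      ≡⟨ v-mul (- 1#) x ⟩
    v (- 1#) +∞ v x   ≡⟨ cong (_+∞ v x) v[-1]≡0 ⟩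
    fin (+ 0) +∞ v x  ≡⟨ +∞-identityˡ (v x) ⟩
    v x               ∎
    where
    open ≡.≡-Reasoning
    v[-1]+v[-1]≡0 : v (- 1#) +∞ v (- 1#) ≡ fin (+ 0)
    v[-1]+v[-1]≡0 = ≡.trans (≡.sym (v-mul (- 1#) (- 1#)))
                      (≡.trans (v-cong (≈-trans (-1*x≈-x (- 1#)) (-‿involutive 1#))) v-1)
    v[-1]≡0 : v (- 1#) ≡ fin (+ 0)
    v[-1]≡0 with v (- 1#) in v[-1]≡
    ... | fin u = cong fin (n+n≡0⇒n≡0 u (fin-injective
                    (≡.trans (cong₂ _+∞_ (≡.sym v[-1]≡) (≡.sym v[-1]≡)) v[-1]+v[-1]≡0)))
    ... | ∞ with ≡.trans (cong (_+∞ v (- 1#)) (≡.sym v[-1]≡)) v[-1]+v[-1]≡0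
    ...   | ()

  v-pow : ∀ {x k} → v x ≡ fin k → ∀ i → v (pow F x i) ≡ fin (+ i ℤ.* k)
  v-pow vx zero    = v-1
  v-pow {k = k} vx (suc i) =
    ≡.trans (v-*-fin (v-pow vx i) vx) (cong fin (≡.trans (ℤP.+-comm _ k) (≡.sym (ℤP.suc-* (+ i) k))))

  v-pow-∞ : ∀ {x} → v x ≡ ∞ → ∀ i → 0 ℕ.< i → v (pow F x i) ≡ ∞
  v-pow-∞ vx (suc i) _ = v-*-∞ʳ vx

  v-+-≥ : ∀ {b x y} → fin b ≤∞ v x → fin b ≤∞ v y → fin b ≤∞ v (x + y)
  v-+-≥ bx by = ≤∞-trans (min∞-glb bx by) (v-add _ _)

  v-+-dominant : ∀ {x y a} → v x ≡ fin a → a <∞ v y → v (x + y) ≡ fin a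
  v-+-dominant {x} {y} {a} vx a<vy =
    ≤∞∧≮∞⇒≡ (v-+-≥ (≤∞-reflexive (≡.sym vx)) (<∞⇒≤∞ a<vy)) a≮v[x+y]
    where
    a≮v[x+y] : ¬ (a <∞ v (x + y))
    a≮v[x+y] a<v[x+y] = <∞-irrefl (subst (a <∞_) (≡.trans (v-cong (//-rightDividesʳ y x)) vx)
                          (v-+-≥ a<v[x+y] (subst (a <∞_) (≡.sym (v-neg y)) a<vy)))

  v-Σ<-≥ : ∀ {b} n h → (∀ j → j ℕ.< n → fin b ≤∞ v (h j)) → fin b ≤∞ v (Σ< F n h)
  v-Σ<-≥ zero    h _     = ≡∞⇒≤∞ v-0
  v-Σ<-≥ (suc n) h bound =
    v-+-≥ (v-Σ<-≥ n h (λ j j<n → bound j (ℕP.m<n⇒m<1+n j<n))) (bound n (ℕP.n<1+n n))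

  v-1-≥ : fin (+ 0) ≤∞ v 1#
  v-1-≥ = ≤∞-reflexive (≡.sym v-1)

  v-four-≥ : fin (+ 0) ≤∞ v (four F)
  v-four-≥ = v-+-≥ (v-+-≥ (v-+-≥ v-1-≥ v-1-≥) v-1-≥) v-1-≥

module Polynomial {c ℓ : Level} (F : Field c ℓ) where
  open Field F renaming (refl to ≈-refl; sym to ≈-sym; trans to ≈-trans)

  term : Poly F → Carrier → ℕ → Carrier
  term p x i = coeff p i * pow F x i

  Σ<-cong : ∀ n {h h′} → (∀ j → j ℕ.< n → h j ≈ h′ j) → Σ< F n h ≈ Σ< F n h′
  Σ<-cong zero    _    = ≈-refl
  Σ<-cong (suc n) h≈h′ = +-cong (Σ<-cong n (λ j j<n → h≈h′ j (ℕP.m<n⇒m<1+n j<n))) (h≈h′ n (ℕP.n<1+n n))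

  Σ<-zero : ∀ n {h} → (∀ j → j ℕ.< n → h j ≈ 0#) → Σ< F n h ≈ 0#
  Σ<-zero zero    _   = ≈-refl
  Σ<-zero (suc n) h≈0 =
    ≈-trans (+-cong (Σ<-zero n (λ j j<n → h≈0 j (ℕP.m<n⇒m<1+n j<n))) (h≈0 n (ℕP.n<1+n n))) (+-identityˡ 0#)

  Σ<-+ : ∀ m n h → Σ< F (m ℕ.+ n) h ≈ Σ< F m h + Σ< F n (λ j → h (m ℕ.+ j))
  Σ<-+ m zero    h rewrite ℕP.+-identityʳ m = ≈-sym (+-identityʳ _)
  Σ<-+ m (suc n) h rewrite ℕP.+-suc m n = ≈-trans (+-congʳ (Σ<-+ m n h)) (+-assoc _ _ _)

  Σ<-*ʳ : ∀ n h x → Σ< F n h * x ≈ Σ< F n (λ j → h j * x)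
  Σ<-*ʳ zero    h x = zeroˡ x
  Σ<-*ʳ (suc n) h x = ≈-trans (distribʳ x _ _) (+-congʳ (Σ<-*ʳ n h x))

  pow-+ : ∀ x m n → pow F x (m ℕ.+ n) ≈ pow F x m * pow F x n
  pow-+ x m zero    rewrite ℕP.+-identityʳ m = ≈-sym (*-identityʳ _)
  pow-+ x m (suc n) rewrite ℕP.+-suc m n = ≈-trans (*-congʳ (pow-+ x m n)) (*-assoc _ _ _)

  Σ<-suc : ∀ n h → Σ< F (suc n) h ≈ h 0 + Σ< F n (λ j → h (suc j))
  Σ<-suc n h = ≈-trans (Σ<-+ 1 n h) (+-congʳ (+-identityˡ (h 0)))

  eval-Σ< : ∀ p x {n} → deg p ℕ.< n → eval F p x ≈ Σ< F n (term p x)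
  eval-Σ< p x dp<n with ℕP.m≤n⇒∃[o]m+o≡n dp<n
  ... | r , refl = ≈-sym (≈-trans (Σ<-+ (suc (deg p)) r (term p x))
                     (≈-trans (+-congˡ (Σ<-zero r λ j _ → terms-vanish j)) (+-identityʳ _)))
    where
    terms-vanish : ∀ j → term p x (suc (deg p) ℕ.+ j) ≈ 0#
    terms-vanish j = ≈-trans (*-congʳ (vanish p _ (ℕP.m≤m+n (suc (deg p)) j))) (zeroˡ _)

  deg-≡ : ∀ (p : Poly F) {n} → ¬ (coeff p n ≈ 0#) → (∀ i → n ℕ.< i → coeff p i ≈ 0#) → deg p ≡ n
  deg-≡ p {n} pₙ≉0 above-n with ℕP.<-cmp (deg p) n
  ... | tri< d<n _ _ = ⊥-elim (pₙ≉0 (vanish p n d<n))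
  ... | tri≈ _ d≡n _ = d≡n
  ... | tri> _ _ n<d = ⊥-elim (lead p (above-n (deg p) n<d))

  shiftCoeff-< : ∀ p {k i} → i ℕ.< k → shiftCoeff F p k i ≈ 0#
  shiftCoeff-< p {k} {i} i<k with k ℕ.≤ᵇ i in k≤ᵇi
  ... | false = ≈-refl
  ... | true  = ⊥-elim (ℕP.<⇒≱ i<k (ℕP.≤ᵇ⇒≤ k i (subst T (≡.sym k≤ᵇi) tt)))

  shiftCoeff-≥ : ∀ p {k i} → k ℕ.≤ i → shiftCoeff F p k i ≈ coeff p (i ℕ.∸ k)
  shiftCoeff-≥ p {k} {i} k≤i with k ℕ.≤ᵇ i in k≤ᵇi
  ... | true  = ≈-refl
  ... | false = ⊥-elim (subst T k≤ᵇi (ℕP.≤⇒≤ᵇ k≤i))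

  shiftCoeff-+ : ∀ p k j → shiftCoeff F p k (k ℕ.+ j) ≈ coeff p j
  shiftCoeff-+ p k j = ≈-trans (shiftCoeff-≥ p (ℕP.m≤m+n k j)) (reflexive (cong (coeff p) (ℕP.m+n∸m≡n k j)))

  shiftCoeff-> : ∀ p {k i} → k ℕ.+ deg p ℕ.< i → shiftCoeff F p k i ≈ 0#
  shiftCoeff-> p {k} {i} k+d<i = ≈-trans (shiftCoeff-≥ p k≤i) (vanish p (i ℕ.∸ k) (m+n<o⇒n<o∸m k+d<i))
    where
    k≤i : k ℕ.≤ i
    k≤i = ℕP.≤-trans (ℕP.m≤m+n k (deg p)) (ℕP.<⇒≤ k+d<i)

module SquareClasses {c ℓ : Level} (F : Field c ℓ) (V : DiscreteValuation F)
                     (henselian : IsHenselian F V) where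
  open Field F renaming (refl to ≈-refl; sym to ≈-sym; trans to ≈-trans)
  open DiscreteValuation V
  open Valuation F V
  open import Algebra.Properties.Group +-group using (x∙y⁻¹≈ε⇒x≈y)
  open SetoidReasoning setoid
  open NaturalCoefficientsSolver commutativeSemiring using (solve; _:=_; con; _:+_; _:*_)

  -- t² + t − x, whose root b gives the square root 1 + 2b of 1 + 4x
  quadratic : Carrier → Poly F
  quadratic x = record { deg = 2 ; coeff = coeffs ; vanish = coeffs-vanish ; lead = λ 1≈0 → 0≉1 (≈-sym 1≈0) }
    where
    coeffs : ℕ → Carrier
    coeffs 0                   = - x
    coeffs 1                   = 1#
    coeffs 2                   = 1#
    coeffs (suc (suc (suc _))) = 0#
    coeffs-vanish : ∀ i → 2 ℕ.< i → coeffs i ≈ 0#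
    coeffs-vanish 0                   ()
    coeffs-vanish 1                   (s≤s ())
    coeffs-vanish 2                   (s≤s (s≤s ()))
    coeffs-vanish (suc (suc (suc _))) _ = ≈-refl

  1+4x-isSquare : ∀ {x} → + 0 <∞ v x → ∃ λ s → s * s ≈ 1# + four F * x
  1+4x-isSquare {x} 0<vx = 1# + (1# + 1#) * b , (begin
    (1# + (1# + 1#) * b) * (1# + (1# + 1#) * b)
      ≈⟨ solve 1 (λ b → (con 1 :+ (con 1 :+ con 1) :* b) :* (con 1 :+ (con 1 :+ con 1) :* b)
                        := con 1 :+ (((con 1 :+ con 1) :+ con 1) :+ con 1) :* (b :* b :+ b)) ≈-refl b ⟩
    1# + four F * (b * b + b)  ≈⟨ +-congˡ (*-congˡ b²+b≈x) ⟩
    1# + four F * x            ∎)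
    where
    integral : ∀ i → fin (+ 0) ≤∞ v (coeff (quadratic x) i)
    integral 0                   = subst (fin (+ 0) ≤∞_) (≡.sym (v-neg x)) (<∞⇒≤∞ 0<vx)
    integral 1                   = v-1-≥
    integral 2                   = v-1-≥
    integral (suc (suc (suc _))) = ≡∞⇒≤∞ v-0
    Q[0]≈-x : eval F (quadratic x) 0# ≈ - x
    Q[0]≈-x = solve 1 (λ y → ((con 0 :+ y :* con 1) :+ con 1 :* (con 1 :* con 0))
                             :+ con 1 :* ((con 1 :* con 0) :* con 0) := y) ≈-refl (- x)
    Q′[0]≈1 : evalDeriv F (quadratic x) 0# ≈ 1#
    Q′[0]≈1 = solve 0 ((con 0 :+ ((con 0 :+ con 1) :* con 1))
                       :+ (((con 0 :+ con 1) :+ con 1) :* (con 1 :* con 0)) := con 1) ≈-refl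
    root : ∃ λ b → (eval F (quadratic x) b ≈ 0#) × (fin (+ 1) ≤∞ v (b + - 0#))
    root = henselian (quadratic x) ≈-refl integral 0# (≡∞⇒≤∞ v-0)
             (subst (fin (+ 1) ≤∞_) (≡.sym (≡.trans (v-cong Q[0]≈-x) (v-neg x))) 0<vx)
             (≡.trans (v-cong Q′[0]≈1) v-1)
    b : Carrier
    b = proj₁ root
    b²+b≈x : b * b + b ≈ x
    b²+b≈x = x∙y⁻¹≈ε⇒x≈y (b * b + b) x (≈-trans (≈-sym (solve 2 (λ y b →
      ((con 0 :+ y :* con 1) :+ con 1 :* (con 1 :* b)) :+ con 1 :* ((con 1 :* b) :* b)
      := (b :* b :+ b) :+ y) ≈-refl (- x) b)) (proj₁ (proj₂ root)))

  -- t = (4y)·e with v e ≥ 1, so y + t = y(1 + 4e) is y times a square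
  sameSquareClass-+ : ∀ {x y t a w} → v (four F) ≡ fin w → v y ≡ fin a → (a ℤ.+ w) <∞ v t →
                      x ≈ y + t → SameSquareClass F x y
  sameSquareClass-+ {x} {y} {t} {a} {w} v4 vy a+w<vt x≈y+t = x≉0 , v≡fin⇒≉0 vy , s , s≉0 , x≈ys²
    where
    v[y4] : v (y * four F) ≡ fin (a ℤ.+ w)
    v[y4] = v-*-fin vy v4
    y4⁻¹ : ∃ λ u → (y * four F) * u ≈ 1#
    y4⁻¹ = inverse (y * four F) (v≡fin⇒≉0 v[y4])
    e : Carrier
    e = t * proj₁ y4⁻¹
    y4e≈t : (y * four F) * e ≈ t
    y4e≈t = begin
      (y * four F) * (t * proj₁ y4⁻¹)  ≈⟨ solve 3 (λ p t u → p :* (t :* u) := t :* (p :* u)) ≈-refl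
                                            (y * four F) t (proj₁ y4⁻¹) ⟩
      t * ((y * four F) * proj₁ y4⁻¹)  ≈⟨ *-congˡ (proj₂ y4⁻¹) ⟩
      t * 1#                           ≈⟨ *-identityʳ t ⟩
      t                                ∎
    0<ve : + 0 <∞ v e
    0<ve = <∞-+∞-cancelˡ (a ℤ.+ w)
             (subst ((a ℤ.+ w) <∞_) (≡.trans (≡.sym (v-cong y4e≈t)) (≡.trans (v-mul _ e) (cong (_+∞ v e) v[y4])))
                a+w<vt)
    s : Carrier
    s = proj₁ (1+4x-isSquare 0<ve)
    x≈ys² : x ≈ y * (s * s)
    x≈ys² = ≈-sym (begin
      y * (s * s)            ≈⟨ *-congˡ (proj₂ (1+4x-isSquare 0<ve)) ⟩
      y * (1# + four F * e)  ≈⟨ solve 3 (λ y q e → y :* (con 1 :+ q :* e) := y :+ (y :* q) :* e)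
                                  ≈-refl y (four F) e ⟩
      y + (y * four F) * e   ≈⟨ +-congˡ y4e≈t ⟩
      y + t                  ≈⟨ x≈y+t ⟨
      x                      ∎)
    a≤a+w : a ℤ.≤ a ℤ.+ w
    a≤a+w = subst (ℤ._≤ a ℤ.+ w) (ℤP.+-identityʳ a)
              (ℤP.+-monoʳ-≤ a (≤∞-fin⁻¹ (subst (fin (+ 0) ≤∞_) v4 v-four-≥)))
    x≉0 : ¬ (x ≈ 0#)
    x≉0 = v≡fin⇒≉0 (≡.trans (v-cong x≈y+t) (v-+-dominant vy (<∞-weaken a≤a+w a+w<vt)))
    s≉0 : ¬ (s ≈ 0#)
    s≉0 s≈0 = x≉0 (≈-trans x≈ys² (≈-trans (*-congˡ (≈-trans (*-congʳ s≈0) (zeroˡ s))) (zeroʳ y)))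

  sameSquareClass-*-square : ∀ {x y y′ p} → SameSquareClass F x y′ → y′ ≈ y * (p * p) → ¬ (p ≈ 0#) →
                             SameSquareClass F x y
  sameSquareClass-*-square {x} {y} {y′} {p} (x≉0 , y′≉0 , s , s≉0 , x≈y′s²) y′≈yp² p≉0 =
    x≉0 , y≉0 , p * s , *-≉0 p≉0 s≉0 , (begin
      x                    ≈⟨ x≈y′s² ⟩
      y′ * (s * s)         ≈⟨ *-congʳ y′≈yp² ⟩
      y * (p * p) * (s * s) ≈⟨ solve 3 (λ y p s → (y :* (p :* p)) :* (s :* s) := y :* ((p :* s) :* (p :* s)))
                                ≈-refl y p s ⟩
      y * ((p * s) * (p * s)) ∎)
    where
    y≉0 : ¬ (y ≈ 0#)
    y≉0 y≈0 = y′≉0 (≈-trans y′≈yp² (≈-trans (*-congʳ y≈0) (zeroˡ _)))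

module Decomposition {c ℓ : Level} (F : Field c ℓ) (f a g z : Poly F) (N : ℕ)
  (da<N : deg a ℕ.< N) (dz<N : deg z ℕ.< N)
  (f≈a+gtᴺ+ztˢ : ∀ i → Field._≈_ F (coeff f i)
     (Field._+_ F (Field._+_ F (coeff a i) (shiftCoeff F g N i))
        (shiftCoeff F z ((2 ℕ.* N ℕ.+ deg g) ℕ.∸ deg z) i))) where
  open Field F renaming (refl to ≈-refl; sym to ≈-sym; trans to ≈-trans)
  open Polynomial F

  S : ℕ
  S = (2 ℕ.* N ℕ.+ deg g) ℕ.∸ deg z

  S≡N+dg+[N∸dz] : S ≡ (N ℕ.+ deg g) ℕ.+ (N ℕ.∸ deg z)
  S≡N+dg+[N∸dz] = ≡.trans (cong (ℕ._∸ deg z) (solve 2 (λ N d → con 2 :* N :+ d := (N :+ d) :+ N) refl N (deg g)))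
                          (ℕP.+-∸-assoc (N ℕ.+ deg g) (ℕP.<⇒≤ dz<N))
    where open Data.Nat.Solver.+-*-Solver

  N+dg<S : N ℕ.+ deg g ℕ.< S
  N+dg<S = subst (N ℕ.+ deg g ℕ.<_) (≡.sym S≡N+dg+[N∸dz]) (ℕP.m<m+n (N ℕ.+ deg g) (ℕP.m<n⇒0<n∸m dz<N))

  N≤S : N ℕ.≤ S
  N≤S = ℕP.≤-trans (ℕP.m≤m+n N (deg g)) (ℕP.<⇒≤ N+dg<S)

  S+dz≡N+dg+N : S ℕ.+ deg z ≡ (N ℕ.+ deg g) ℕ.+ N
  S+dz≡N+dg+N = ≡.trans (cong (ℕ._+ deg z) S≡N+dg+[N∸dz])
    (≡.trans (ℕP.+-assoc (N ℕ.+ deg g) _ _) (cong (N ℕ.+ deg g ℕ.+_) (ℕP.m∸n+n≡m (ℕP.<⇒≤ dz<N))))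

  S-even : 2 ∣ deg g → 2 ∣ deg z → ∃ λ h → S ≡ h ℕ.+ h
  S-even (divides qg refl) (divides qz refl) = (N ℕ.+ qg) ℕ.∸ qz , (begin
    (2 ℕ.* N ℕ.+ qg ℕ.* 2) ℕ.∸ qz ℕ.* 2  ≡⟨ cong (ℕ._∸ qz ℕ.* 2)
                                              (solve 2 (λ N q → con 2 :* N :+ q :* con 2 := (N :+ q) :* con 2) refl N qg) ⟩
    (N ℕ.+ qg) ℕ.* 2 ℕ.∸ qz ℕ.* 2       ≡⟨ ℕP.*-distribʳ-∸ 2 (N ℕ.+ qg) qz ⟨
    ((N ℕ.+ qg) ℕ.∸ qz) ℕ.* 2           ≡⟨ solve 1 (λ h → h :* con 2 := h :+ h) refl ((N ℕ.+ qg) ℕ.∸ qz) ⟩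
    (N ℕ.+ qg) ℕ.∸ qz ℕ.+ ((N ℕ.+ qg) ℕ.∸ qz) ∎)
    where
    open Data.Nat.Solver.+-*-Solver
    open ≡.≡-Reasoning

  private
    coeff-f≈ : ∀ {i x y u} → coeff a i ≈ x → shiftCoeff F g N i ≈ y → shiftCoeff F z S i ≈ u →
               coeff f i ≈ (x + y) + u
    coeff-f≈ {i} aᵢ≈x gᵢ≈y zᵢ≈u = ≈-trans (f≈a+gtᴺ+ztˢ i) (+-cong (+-cong aᵢ≈x gᵢ≈y) zᵢ≈u)

    N≤⇒aᵢ≈0 : ∀ {i} → N ℕ.≤ i → coeff a i ≈ 0#
    N≤⇒aᵢ≈0 N≤i = vanish a _ (ℕP.<-≤-trans da<N N≤i)

  coeff-f-low : ∀ {i} → i ℕ.< N → coeff f i ≈ coeff a i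
  coeff-f-low i<N = ≈-trans (coeff-f≈ ≈-refl (shiftCoeff-< g i<N) (shiftCoeff-< z (ℕP.<-≤-trans i<N N≤S)))
                            (≈-trans (+-identityʳ _) (+-identityʳ _))

  coeff-f-middle : ∀ {i} → N ℕ.+ deg g ℕ.< i → i ℕ.< S → coeff f i ≈ 0#
  coeff-f-middle N+dg<i i<S =
    ≈-trans (coeff-f≈ (N≤⇒aᵢ≈0 (ℕP.≤-trans (ℕP.m≤m+n _ _) (ℕP.<⇒≤ N+dg<i)))
                      (shiftCoeff-> g N+dg<i) (shiftCoeff-< z i<S))
            (≈-trans (+-identityʳ _) (+-identityʳ 0#))

  coeff-f-high : ∀ j → coeff f (S ℕ.+ j) ≈ coeff z j
  coeff-f-high j = ≈-trans (coeff-f≈ (N≤⇒aᵢ≈0 (ℕP.≤-trans N≤S S≤S+j)) (shiftCoeff-> g (ℕP.<-≤-trans N+dg<S S≤S+j))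
                                     (shiftCoeff-+ z S j))
                           (≈-trans (+-congʳ (+-identityʳ 0#)) (+-identityˡ _))
    where
    S≤S+j : S ℕ.≤ S ℕ.+ j
    S≤S+j = ℕP.m≤m+n S j

  deg-f : deg f ≡ S ℕ.+ deg z
  deg-f = deg-≡ f (λ f[S+dz]≈0 → lead z (≈-trans (≈-sym (coeff-f-high (deg z))) f[S+dz]≈0)) beyond
    where
    beyond : ∀ i → S ℕ.+ deg z ℕ.< i → coeff f i ≈ 0#
    beyond i S+dz<i = ≈-trans (reflexive (cong (coeff f) (≡.sym (ℕP.m+[n∸m]≡n S≤i))))
                              (≈-trans (coeff-f-high (i ℕ.∸ S)) (vanish z _ (m+n<o⇒n<o∸m S+dz<i)))
      where
      S≤i : S ℕ.≤ i
      S≤i = ℕP.≤-trans (ℕP.m≤m+n S (deg z)) (ℕP.<⇒≤ S+dz<i)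

  eval-a≈f-truncated : ∀ x → eval F a x ≈ Σ< F N (term f x)
  eval-a≈f-truncated x = ≈-trans (eval-Σ< a x da<N) (Σ<-cong N λ i i<N → *-congʳ (≈-sym (coeff-f-low i<N)))

  eval-f≈eval-a+tail : ∀ x → eval F f x ≈ eval F a x + Σ< F (suc (deg f)) (λ j → term f x (N ℕ.+ j))
  eval-f≈eval-a+tail x = ≈-trans (eval-Σ< f x (ℕP.m≤n+m (suc (deg f)) N))
    (≈-trans (Σ<-+ N (suc (deg f)) (term f x)) (+-congʳ (≈-sym (eval-a≈f-truncated x))))

  eval-f≈head+top : ∀ x → eval F f x ≈ Σ< F S (term f x) + Σ< F (suc (deg z)) (λ j → term f x (S ℕ.+ j))
  eval-f≈head+top x = ≈-trans (eval-Σ< f x (subst (ℕ._< S ℕ.+ suc (deg z)) (≡.sym deg-f) S+dz<S+1+dz))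
                              (Σ<-+ S (suc (deg z)) (term f x))
    where
    S+dz<S+1+dz : S ℕ.+ deg z ℕ.< S ℕ.+ suc (deg z)
    S+dz<S+1+dz = ℕP.+-monoʳ-< S (ℕP.n<1+n (deg z))

  top≈eval-z*xˢ : ∀ x → Σ< F (suc (deg z)) (λ j → term f x (S ℕ.+ j)) ≈ eval F z x * pow F x S
  top≈eval-z*xˢ x = begin
    Σ< F (suc (deg z)) (λ j → term f x (S ℕ.+ j))     ≈⟨ Σ<-cong (suc (deg z)) (λ j _ → term-f-high j) ⟩
    Σ< F (suc (deg z)) (λ j → term z x j * pow F x S) ≈⟨ Σ<-*ʳ (suc (deg z)) (term z x) (pow F x S) ⟨
    eval F z x * pow F x S                             ∎
    where
    open SetoidReasoning setoid
    open NaturalCoefficientsSolver commutativeSemiring using (solve; _:=_; _:*_)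
    term-f-high : ∀ j → term f x (S ℕ.+ j) ≈ term z x j * pow F x S
    term-f-high j = ≈-trans (*-cong (coeff-f-high j) (pow-+ x S j))
      (solve 3 (λ p q r → p :* (q :* r) := (p :* r) :* q) ≈-refl (coeff z j) (pow F x S) (pow F x j))

  deg-f-split-low : ∀ {i} → i ℕ.≤ N ℕ.+ deg g → ∃ λ r → deg f ≡ i ℕ.+ r × N ℕ.≤ r
  deg-f-split-low {i} i≤N+dg with ℕP.m≤n⇒∃[o]m+o≡n i≤N+dg
  ... | o , i+o≡N+dg = o ℕ.+ N , ≡.trans deg-f (≡.trans S+dz≡N+dg+N
                          (≡.trans (cong (ℕ._+ N) (≡.sym i+o≡N+dg)) (ℕP.+-assoc i o N))) , ℕP.m≤n+m N o

  deg-f-split-top : ∀ {j} → j ℕ.< deg z → ∃ λ r → deg f ≡ (S ℕ.+ j) ℕ.+ r × 1 ℕ.≤ r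
  deg-f-split-top {j} j<dz with ℕP.m≤n⇒∃[o]m+o≡n j<dz
  ... | o , 1+j+o≡dz = suc o , ≡.trans deg-f (≡.trans (cong (S ℕ.+_) (≡.sym 1+j+o≡dz)) S+[1+j+o]≡S+j+[1+o]) , s≤s z≤n
    where
    open Data.Nat.Solver.+-*-Solver
    S+[1+j+o]≡S+j+[1+o] : S ℕ.+ (suc j ℕ.+ o) ≡ (S ℕ.+ j) ℕ.+ suc o
    S+[1+j+o]≡S+j+[1+o] = solve 3 (λ S j o → S :+ (con 1 :+ j :+ o) := (S :+ j) :+ (con 1 :+ o)) refl S j o

module NewtonLine {c ℓ : Level} (F : Field c ℓ) (V : DiscreteValuation F) (f : Poly F) (m : ℚ) (w₀ : ℤ)
  (on-or-above : ∀ i → i ℕ.≤ deg f →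
     AboveOrOn F V (ℤ→ℚ w₀ ℚ.+ ℕ→ℚ i ℚ.* m) (DiscreteValuation.v V (coeff f i)))
  {α : Field.Carrier F} {k : ℤ} (vα : DiscreteValuation.v V α ≡ fin k) where
  open DiscreteValuation V
  open Valuation F V
  open Polynomial F
  open import Data.Rational using (_+_; _*_; _<_; ∣_∣)

  -- the Newton polygon of f(αu) is that of f with every slope shifted by v(α)
  slope : ℚ
  slope = m + ℤ→ℚ k

  line : ℕ → ℚ
  line i = ℤ→ℚ w₀ + ℕ→ℚ i * slope

  v-term-> : ∀ b i → ℤ→ℚ b < line i → b <∞ v (term f α i)
  v-term-> b i b<line with i ℕP.≤? deg f
  ... | no  i≰d = ≡∞⇒≤∞ (v-*-∞ˡ (0⇒v-∞ _ (vanish f i (ℕP.≰⇒> i≰d))))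
  ... | yes i≤d with v (coeff f i) in vfᵢ | on-or-above i i≤d
  ...   | ∞      | _       = ≡∞⇒≤∞ (v-*-∞ˡ vfᵢ)
  ...   | fin wᵢ | line≤wᵢ = subst (b <∞_) (≡.sym (v-*-fin vfᵢ (v-pow vα i)))
    (fin≤fin (ℤP.i<j⇒suc[i]≤j (ℤ→ℚ-cancel-< {b} (ℚP.<-≤-trans b<line (line-shift w₀ wᵢ k i m line≤wᵢ)))))

  v-term-gap : ∀ b x i {n r} → line i ≡ ℤ→ℚ b + ℕ→ℚ r * ∣ slope ∣ →
               ℤ→ℚ x < ℕ→ℚ n * ∣ slope ∣ → n ℕ.≤ r → (b ℤ.+ x) <∞ v (term f α i)
  v-term-gap b x i line≡ x<n∣d∣ n≤r =
    v-term-> (b ℤ.+ x) i (subst (ℤ→ℚ (b ℤ.+ x) <_) (≡.sym line≡) (+-gap b x x<n∣d∣ n≤r))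

  v-term-gap₀ : ∀ b i {r} → line i ≡ ℤ→ℚ b + ℕ→ℚ r * ∣ slope ∣ → 0ℚ < ∣ slope ∣ → 1 ℕ.≤ r →
                b <∞ v (term f α i)
  v-term-gap₀ b i line≡ 0<∣d∣ 1≤r = subst (_<∞ v (term f α i)) (ℤP.+-identityʳ b)
    (v-term-gap b (+ 0) i line≡ (subst (0ℚ <_) (≡.sym (ℚP.*-identityˡ ∣ slope ∣)) 0<∣d∣) 1≤r)

module Proposition {c ℓ : Level} (F : Field c ℓ) (V : DiscreteValuation F) (henselian : IsHenselian F V)
  (α : Field.Carrier F) (f a g z : Poly F) (m : ℚ) (N : ℕ)
  (w₀ : ℤ) (vf₀ : DiscreteValuation.v V (coeff f 0) ≡ fin w₀)
  (on-or-above : ∀ i → i ℕ.≤ deg f →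
     AboveOrOn F V (ℤ→ℚ w₀ ℚ.+ ℕ→ℚ i ℚ.* m) (DiscreteValuation.v V (coeff f i)))
  (w : ℤ) (v4 : DiscreteValuation.v V (four F) ≡ fin w)
  (gap : (DiscreteValuation.v V α ≡ ∞ × 0 ℕ.< N) ⊎
         (∃ λ k → DiscreteValuation.v V α ≡ fin k × ℤ→ℚ w ℚ.< ℕ→ℚ N ℚ.* ℚ.∣ m ℚ.+ ℤ→ℚ k ∣))
  (da<N : deg a ℕ.< N) (dz<N : deg z ℕ.< N)
  (f≈a+gtᴺ+ztˢ : ∀ i → Field._≈_ F (coeff f i)
     (Field._+_ F (Field._+_ F (coeff a i) (shiftCoeff F g N i))
        (shiftCoeff F z ((2 ℕ.* N ℕ.+ deg g) ℕ.∸ deg z) i))) where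
  open Field F renaming (refl to ≈-refl; sym to ≈-sym; trans to ≈-trans)
  open DiscreteValuation V
  open Valuation F V
  open Polynomial F
  open SquareClasses F V henselian
  open Decomposition F f a g z N da<N dz<N f≈a+gtᴺ+ztˢ

  gap-at : ∀ {k} → v α ≡ fin k → ℤ→ℚ w ℚ.< ℕ→ℚ N ℚ.* ℚ.∣ m ℚ.+ ℤ→ℚ k ∣
  gap-at vα =
    [ (λ (vα≡∞ , _) → ⊥-elim (fin≢∞ (≡.trans (≡.sym vα) vα≡∞)))
    , (λ (_ , vα≡k′ , w<N∣m+k′∣) → subst (λ k → ℤ→ℚ w ℚ.< ℕ→ℚ N ℚ.* ℚ.∣ m ℚ.+ ℤ→ℚ k ∣)
                                       (fin-injective (≡.trans (≡.sym vα≡k′) vα)) w<N∣m+k′∣)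
    ] gap

  v-term-0 : v (term f α 0) ≡ fin w₀
  v-term-0 = ≡.trans (v-cong (*-identityʳ (coeff f 0))) vf₀

  terms-above : SlopeAbove F V m α →
                (∀ j → w₀ <∞ v (term f α (suc j))) × (∀ j → (w₀ ℤ.+ w) <∞ v (term f α (N ℕ.+ j)))
  terms-above (inj₁ vα≡∞) =
    (λ j → ≡∞⇒≤∞ (v-*-∞ʳ (v-pow-∞ vα≡∞ (suc j) (s≤s z≤n)))) ,
    (λ j → ≡∞⇒≤∞ (v-*-∞ʳ (v-pow-∞ vα≡∞ (N ℕ.+ j) (ℕP.<-≤-trans (ℕP.≤-<-trans z≤n da<N) (ℕP.m≤m+n N j)))))
  terms-above (inj₂ (k , vα , -k<m)) =
    (λ j → v-term-gap₀ w₀ (suc j) {suc j} (line≡ (suc j)) 0<∣slope∣ (s≤s z≤n)) ,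
    (λ j → v-term-gap w₀ w (N ℕ.+ j) {N} {N ℕ.+ j} (line≡ (N ℕ.+ j)) (gap-at vα) (ℕP.m≤m+n N j))
    where
    open NewtonLine F V f m w₀ on-or-above vα
    0<slope : 0ℚ ℚ.< slope
    0<slope = subst (ℚ._< slope) (ℚP.+-inverseˡ (ℤ→ℚ k)) (ℚP.+-monoˡ-< (ℤ→ℚ k) -k<m)
    ∣slope∣≡slope : ℚ.∣ slope ∣ ≡ slope
    ∣slope∣≡slope = ℚP.0≤p⇒∣p∣≡p (ℚP.<⇒≤ 0<slope)
    0<∣slope∣ : 0ℚ ℚ.< ℚ.∣ slope ∣
    0<∣slope∣ = subst (0ℚ ℚ.<_) (≡.sym ∣slope∣≡slope) 0<slope
    line≡ : ∀ i → line i ≡ ℤ→ℚ w₀ ℚ.+ ℕ→ℚ i ℚ.* ℚ.∣ slope ∣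
    line≡ i = cong (λ e → ℤ→ℚ w₀ ℚ.+ ℕ→ℚ i ℚ.* e) (≡.sym ∣slope∣≡slope)

  sameSquareClass-above : SlopeAbove F V m α → SameSquareClass F (eval F f α) (eval F a α)
  sameSquareClass-above above =
    sameSquareClass-+ v4 v-eval-a (v-Σ<-≥ (suc (deg f)) _ λ j _ → proj₂ (terms-above above) j)
                      (eval-f≈eval-a+tail α)
    where
    N≡1+r : ∃ λ r → 1 ℕ.+ r ≡ N
    N≡1+r = ℕP.m≤n⇒∃[o]m+o≡n (ℕP.≤-<-trans z≤n da<N)
    eval-a≈head+rest : eval F a α ≈ term f α 0 + Σ< F (proj₁ N≡1+r) (λ j → term f α (suc j))
    eval-a≈head+rest = ≈-trans (eval-a≈f-truncated α)
      (≈-trans (reflexive (cong (λ n → Σ< F n (term f α)) (≡.sym (proj₂ N≡1+r)))) (Σ<-suc _ (term f α)))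
    v-eval-a : v (eval F a α) ≡ fin w₀
    v-eval-a = ≡.trans (v-cong eval-a≈head+rest)
                 (v-+-dominant v-term-0 (v-Σ<-≥ (proj₁ N≡1+r) _ λ j _ → proj₁ (terms-above above) j))

  module Below (wd : ℤ) (vfd : v (coeff f (deg f)) ≡ fin wd)
               (edge : ℤ→ℚ wd ≡ ℤ→ℚ w₀ ℚ.+ ℕ→ℚ (deg f) ℚ.* m)
               {k : ℤ} (vα : v α ≡ fin k) (m<-k : m ℚ.< ℚ.- ℤ→ℚ k) where
    open NewtonLine F V f m w₀ on-or-above vα

    w-top : ℤ
    w-top = wd ℤ.+ + deg f ℤ.* k

    slope<0 : slope ℚ.< 0ℚ
    slope<0 = subst (slope ℚ.<_) (ℚP.+-inverseˡ (ℤ→ℚ k)) (ℚP.+-monoˡ-< (ℤ→ℚ k) m<-k)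

    0<∣slope∣ : 0ℚ ℚ.< ℚ.∣ slope ∣
    0<∣slope∣ = subst (0ℚ ℚ.<_) (≡.sym (p<0⇒∣p∣≡-p slope<0)) (ℚP.neg-antimono-< slope<0)

    line≡ : ∀ i r → deg f ≡ i ℕ.+ r → line i ≡ ℤ→ℚ w-top ℚ.+ ℕ→ℚ r ℚ.* ℚ.∣ slope ∣
    line≡ i r d≡i+r = line-descending (ℤ→ℚ w₀) w-top i r slope<0
      (≡.trans (line-shift-≡ w₀ wd k (deg f) m edge) (cong (λ n → ℤ→ℚ w₀ ℚ.+ ℕ→ℚ n ℚ.* slope) d≡i+r))

    v-term-top : v (term f α (S ℕ.+ deg z)) ≡ fin w-top
    v-term-top = subst (λ n → v (term f α n) ≡ fin w-top) deg-f (v-*-fin vfd (v-pow vα (deg f)))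

    terms-below-top : ∀ j → j ℕ.< deg z → w-top <∞ v (term f α (S ℕ.+ j))
    terms-below-top j j<dz with deg-f-split-top j<dz
    ... | r , d≡S+j+r , 1≤r = v-term-gap₀ w-top (S ℕ.+ j) {r} (line≡ (S ℕ.+ j) r d≡S+j+r) 0<∣slope∣ 1≤r

    terms-head : ∀ i → i ℕ.< S → (w-top ℤ.+ w) <∞ v (term f α i)
    terms-head i i<S with i ℕP.≤? N ℕ.+ deg g
    ... | no  i≰N+dg = ≡∞⇒≤∞ (v-*-∞ˡ (0⇒v-∞ _ (coeff-f-middle (ℕP.≰⇒> i≰N+dg) i<S)))
    ... | yes i≤N+dg with deg-f-split-low i≤N+dg
    ...   | r , d≡i+r , N≤r = v-term-gap w-top w i {N} {r} (line≡ i r d≡i+r) (gap-at vα) N≤r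

    top-part : Carrier
    top-part = Σ< F (suc (deg z)) (λ j → term f α (S ℕ.+ j))

    sameSquareClass-top : SameSquareClass F (eval F f α) top-part
    sameSquareClass-top = sameSquareClass-+ v4 v-top-part (v-Σ<-≥ S _ terms-head)
                            (≈-trans (eval-f≈head+top α) (+-comm _ _))
      where
      v-top-part : v top-part ≡ fin w-top
      v-top-part = ≡.trans (v-cong (+-comm _ _)) (v-+-dominant v-term-top (v-Σ<-≥ (deg z) _ terms-below-top))

  sameSquareClass-below : 2 ∣ deg g → 2 ∣ deg z →
                          (wd : ℤ) → v (coeff f (deg f)) ≡ fin wd → ℤ→ℚ wd ≡ ℤ→ℚ w₀ ℚ.+ ℕ→ℚ (deg f) ℚ.* m →
                          SlopeBelow F V m α → SameSquareClass F (eval F f α) (eval F z α)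
  sameSquareClass-below 2∣dg 2∣dz wd vfd edge (k , vα , m<-k) with S-even 2∣dg 2∣dz
  ... | h , S≡h+h = sameSquareClass-*-square sameSquareClass-top top-part≈zα*αʰαʰ (v≡fin⇒≉0 (v-pow vα h))
    where
    open Below wd vfd edge vα m<-k
    top-part≈zα*αʰαʰ : top-part ≈ eval F z α * (pow F α h * pow F α h)
    top-part≈zα*αʰαʰ = ≈-trans (top≈eval-z*xˢ α)
                         (*-congˡ (≈-trans (reflexive (cong (pow F α) S≡h+h)) (pow-+ α h h)))

open import Data.Nat using (_<_; _+_; _*_; _∸_)

proposition2p11 :
  ∀ {c ℓ : Level} (F : Field c ℓ) (V : DiscreteValuation F) →
  IsHenselian F V →
  (α : Field.Carrier F) (f a g z : Poly F) (m : ℚ) (N : ℕ) →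
  2 ∣ deg f →
  ¬ (Field._≈_ F (coeff f 0) (Field.0# F)) →
  NewtonPolygonOneEdge F V f m →
  SlopeNeq F V m α →
  NBound F V N m α →
  2 ∣ deg g →
  2 ∣ deg z →
  deg a < N →
  deg z < N →
  (∀ i → Field._≈_ F (coeff f i)
     (Field._+_ F (Field._+_ F (coeff a i) (shiftCoeff F g N i))
        (shiftCoeff F z ((2 * N + deg g) ∸ deg z) i))) →
  (SlopeBelow F V m α → SameSquareClass F (eval F f α) (eval F z α)) ×
  (SlopeAbove F V m α → SameSquareClass F (eval F f α) (eval F a α))
-- Evenness of deg f, f(0) ≠ 0 and m ≠ −v(α) are not needed: each case carries its own slope
-- condition, and NBound already supplies the gap w < N·|m + v(α)|.
proposition2p11 F V henselian α f a g z m N _ _ (_ , w₀ , vf₀ , (wd , vfd , edge) , on-or-above) _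
                (w , v4 , gap) 2∣dg 2∣dz da<N dz<N f≈a+gtᴺ+ztˢ =
  sameSquareClass-below 2∣dg 2∣dz wd vfd edge , sameSquareClass-above
  where
  open Proposition F V henselian α f a g z m N w₀ vf₀ on-or-above w v4 gap da<N dz<N f≈a+gtᴺ+ztˢ
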